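{- Let $\mathcal{M}_{\mathrm{BLin}}$ be the bilinear infinite counting automaton with states $\mathbb{Z}$, initial state $0$, final states $\{0\}$, and transitions in parallel as follows: for every $i\ge0$ a loop at $i$ labelled $h_i(z)$, a transition from $i$ to $i+1$ labelled $f_i(z)$ and a transition from $i+1$ to $i$ labelled $g_i(z)$; for every $i\ge1$ a loop at $-i$ labelled $h'_i(z)$; and for every $i\ge0$ a transition from $-i$ to $-(i+1)$ labelled $g'_i(z)$ and a transition from $-(i+1)$ to $-i$ labelled $f'_i(z)$. Then the generating function of $\mathcal{M}_{\mathrm{BLin}}$ is $$E_b(z)=\frac{1}{1-h_0(z)-f_0(z)g_0(z)E_1(z)-f'_0(z)g'_0(z)E'_1(z)},$$ where $$E_1(z)=\cfrac{1}{1-h_1(z)-\cfrac{f_1(z)g_1(z)}{1-h_2(z)-\cfrac{f_2(z)g_2(z)}{\ddots}}},\qquad E'_1(z)=\cfrac{1}{1-h'_1(z)-\cfrac{f'_1(z)g'_1(z)}{1-h'_2(z)-\cfrac{f'_2(z)g'_2(z)}{\ddots}}}.$$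
   Context: A transition in parallel labelled $f(z)=\sum_{n\ge1}f_nz^n$ ($f_n\in\mathbb{N}$, zero constant term) from state $p$ to state $q$ stands for: for each $n\ge1$, $f_n$ disjoint chains of $n$ transitions labelled $z$ from $p$ to $q$ through $n-1$ new hidden non-final states, from each of which only the next transition of the chain starts. The generating function of a counting automaton is $\sum_n a_nz^n$ with $a_n$ the number of paths of $n$ transitions (all transitions in parallel expanded) from the initial state to a final state. Infinite continued fractions are coefficientwise limits of their finite truncations. -}

module Defs where

open import Data.Nat using (ℕ; zero; suc; _+_; _*_; _∸_; _≤_)
open import Data.Integer using (ℤ; +_; -[1+_])
open import Data.List using (map; upTo)
open import Data.Nat.ListAction using (sum)
open import Relation.Binary.PropositionalEquality using (_≡_)
open import Data.Product using (Σ; ∃)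

-- Formal power series with coefficients in ℕ: the n-th coefficient.

Series : Set
Series = ℕ → ℕ

one : Series
one zero    = 1
one (suc n) = 0

infixl 6 _⊕_
infixl 7 _⊗_

_⊕_ : Series → Series → Series
(a ⊕ b) n = a n + b n

_⊗_ : Series → Series → Series
(a ⊗ b) n = sum (map (λ k → a k * b (n ∸ k)) (upTo (suc n)))

-- Quasi-inverse  inv X = 1 / (1 - X)  (for X with zero constant term):
-- the unique series c with c = 1 + X·c, i.e.
--   c_0 = 1,  c_{n+1} = Σ_{m=0}^{n} X_{n+1-m} c_m.
-- invAux X d n = Σ_{m=0}^{n} X_{d+n+1-m} c_m.

mutual
  inv : Series → Series
  inv X zero    = 1
  inv X (suc n) = invAux X 0 n

  invAux : Series → ℕ → ℕ → ℕ
  invAux X d zero    = X (suc d) * inv X 0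
  invAux X d (suc n) = X (suc d) * inv X (suc n) + invAux X (suc d) n

-- Finite truncations of the continued fraction
--   K_j = 1 / (1 - h_j - f_j g_j / (1 - h_{j+1} - f_{j+1} g_{j+1} / ...))
-- trunc h f g m j : depth-m truncation starting at index j.

trunc : (h f g : ℕ → Series) → ℕ → ℕ → Series
trunc h f g zero    j = inv (h j)
trunc h f g (suc m) j = inv (h j ⊕ f j ⊗ g j ⊗ trunc h f g m (suc j))

IsLimit : (ℕ → Series) → Series → Set
IsLimit s L = ∀ n → ∃ λ M → ∀ m → M ≤ m → s m n ≡ L n

-- paths n s = number of paths of n transitions (all transitions in
-- parallel expanded into chains) from state s to the final state 0.
-- Since hidden chain states have a single outgoing transition, a path
-- leaving a real state s through a chain of length k of a parallel
-- transition labelled φ towards q (φ_k such chains) continues as a path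
-- of length n-k from q.  Hence
--   paths 0 s      = [s = 0]
--   paths (n+1) s  = Σ_{(φ,q) out of s} Σ_{k=1}^{n+1} φ_k · paths (n+1-k) q.
-- chains φ q d n = Σ_{m=0}^{n} φ_{d+n+1-m} · paths m q.

module BLin (h f g h' f' g' : ℕ → Series) where

  isZero : ℤ → ℕ
  isZero (+ zero)  = 1
  isZero (+ suc _) = 0
  isZero -[1+ _ ]  = 0

  neg : ℕ → ℤ
  neg zero    = + 0
  neg (suc i) = -[1+ i ]

  mutual
    paths : ℕ → ℤ → ℕ
    paths zero    s           = isZero s
    paths (suc n) (+ zero)    =
      chains (h 0) (+ 0) 0 n + chains (f 0) (+ 1) 0 n + chains (g' 0) -[1+ 0 ] 0 n
    paths (suc n) (+ suc i)   =
      chains (h (suc i)) (+ suc i) 0 n + chains (f (suc i)) (+ suc (suc i)) 0 n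
        + chains (g i) (+ i) 0 n
    paths (suc n) -[1+ i ]    =
      chains (h' (suc i)) -[1+ i ] 0 n + chains (g' (suc i)) -[1+ suc i ] 0 n
        + chains (f' i) (neg i) 0 n

    chains : Series → ℤ → ℕ → ℕ → ℕ
    chains φ q d zero    = φ (suc d) * paths 0 q
    chains φ q d (suc n) = φ (suc d) * paths (suc n) q + chains φ q (suc d) n

  genFun : Series
  genFun n = paths n (+ 0)

  Eb : Series → Series → Series
  Eb E1 E1' = inv (h 0 ⊕ f 0 ⊗ g 0 ⊗ E1 ⊕ f' 0 ⊗ g' 0 ⊗ E1')

module Submission where

-- Let P s count the paths from state s to 0. Splitting a path after its first parallel transition
-- gives the linear system  P s = [s = 0] + Σ_{s →φ q} φ · P q.  Since no label has a constant term,
-- the n-th coefficient of the right-hand side only involves coefficients of degree < n, so the system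
-- has at most one solution. The depth-m truncation of a continued fraction is already exact up to
-- degree m, so the truncations converge and their limits satisfy E_j = 1 / (1 - h_j - f_j g_j E_{j+1}).
-- This identity makes E_b · Π_{k<i} g_k E_{k+1} at state i and E_b · Π_{k<i} f'_k E'_{k+1} at state -i
-- a solution of the system, whose value at state 0 is E_b.

open import Algebra.Bundles using (CommutativeSemiring)
import Algebra.Solver.Ring.NaturalCoefficients.Default as SemiringSolver
import Relation.Binary.Reasoning.Setoid as SetoidReasoning

-- Placed before the ℕ imports, whose _+_ and _*_ would clash with those of S.
module Balance {c ℓ} (S : CommutativeSemiring c ℓ) where
  open CommutativeSemiring S
  open SemiringSolver S using (solve; _:+_; _:*_; _:=_; con)
  open SetoidReasoning setoid

  rung-balance : ∀ r g a h f g⁺ e {k} → k ≈ f * g⁺ → a ≈ 1# + (h + k * e) * a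
    → r * (g * a) ≈ h * (r * (g * a)) + f * (r * (g * a) * (g⁺ * e)) + g * r
  rung-balance r g a h f g⁺ e {k} k≈fg⁺ a-fixed = begin
    r * (g * a)
      ≈⟨ *-congˡ (*-congˡ a-fixed) ⟩
    r * (g * (1# + (h + k * e) * a))
      ≈⟨ *-congˡ (*-congˡ (+-congˡ (*-congʳ (+-congˡ (*-congʳ k≈fg⁺))))) ⟩
    r * (g * (1# + (h + f * g⁺ * e) * a))
      ≈⟨ solve 7 (λ r g a h f g⁺ e → r :* (g :* (con 1 :+ (h :+ f :* g⁺ :* e) :* a))
                   := h :* (r :* (g :* a)) :+ f :* (r :* (g :* a) :* (g⁺ :* e)) :+ g :* r)
               refl r g a h f g⁺ e ⟩
    h * (r * (g * a)) + f * (r * (g * a) * (g⁺ * e)) + g * r ∎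

  root-balance : ∀ b h f g e f' g' e' → b ≈ 1# + (h + f * g * e + f' * g' * e') * b
    → b ≈ 1# + (h * b + f * (b * (g * e)) + g' * (b * (f' * e')))
  root-balance b h f g e f' g' e' b-fixed = begin
    b
      ≈⟨ b-fixed ⟩
    1# + (h + f * g * e + f' * g' * e') * b
      ≈⟨ solve 8 (λ b h f g e f' g' e' → con 1 :+ (h :+ f :* g :* e :+ f' :* g' :* e') :* b
                   := con 1 :+ (h :* b :+ f :* (b :* (g :* e)) :+ g' :* (b :* (f' :* e'))))
               refl b h f g e f' g' e' ⟩
    1# + (h * b + f * (b * (g * e)) + g' * (b * (f' * e'))) ∎

open import Level using (0ℓ)
open import Data.Nat using (ℕ; zero; suc; _+_; _*_; _∸_; _≤_; _<_; z≤n; s≤s)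
open import Data.Nat.Properties
  using (+-identityʳ; +-suc; +-assoc; +-comm; *-comm; *-assoc; *-distribʳ-+; *-distribˡ-+;
         +-commutativeSemigroup; ≤-refl; ≤-trans; ≤-pred; m<n⇒m<1+n; m<1+n⇒m<n∨m≡n)
open import Data.Nat.ListAction using (sum)
open import Data.List using (applyUpTo)
open import Data.List.Properties using (map-applyUpTo)
import Data.Integer as ℤ
open ℤ using (ℤ; +0; +[1+_]; -[1+_])
open import Data.Product using (Σ; _×_; _,_)
open import Data.Sum using (inj₁; inj₂)
open import Function using (id)
open import Relation.Binary.PropositionalEquality using (_≡_; refl; sym; trans; cong; cong₂; module ≡-Reasoning)
open import Relation.Binary.Structures using (IsEquivalence)
open import Algebra.Properties.CommutativeSemigroup +-commutativeSemigroup using (interchange)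
import Data.Nat.Solver

open import Defs

infix 4 _≈_
_≈_ : Series → Series → Set
a ≈ b = ∀ n → a n ≡ b n

𝟘 : Series
𝟘 _ = 0

drop : ℕ → Series → Series
drop d a k = a (d + k)

scale : ℕ → Series → Series
scale c a n = c * a n

-- The Cauchy product by recursion on the degree, which makes it amenable to induction.
infixl 7 _⋆_
_⋆_ : Series → Series → Series
(a ⋆ b) zero    = a 0 * b 0
(a ⋆ b) (suc n) = a 0 * b (suc n) + (drop 1 a ⋆ b) n

⋆-cong : ∀ {a a' b b'} → a ≈ a' → b ≈ b' → a ⋆ b ≈ a' ⋆ b'
⋆-cong p q zero    = cong₂ _*_ (p 0) (q 0)
⋆-cong p q (suc n) = cong₂ _+_ (cong₂ _*_ (p 0) (q (suc n))) (⋆-cong (λ k → p (suc k)) q n)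

⋆-zeroˡ : ∀ b → 𝟘 ⋆ b ≈ 𝟘
⋆-zeroˡ b zero    = refl
⋆-zeroˡ b (suc n) = ⋆-zeroˡ b n

⋆-identityˡ : ∀ b → one ⋆ b ≈ b
⋆-identityˡ b zero    = +-identityʳ (b 0)
⋆-identityˡ b (suc n) = begin
  b (suc n) + 0 + (𝟘 ⋆ b) n ≡⟨ cong₂ _+_ (+-identityʳ (b (suc n))) (⋆-zeroˡ b n) ⟩
  b (suc n) + 0             ≡⟨ +-identityʳ (b (suc n)) ⟩
  b (suc n)                 ∎
  where open ≡-Reasoning

⋆-distribʳ : ∀ c a b → (a ⊕ b) ⋆ c ≈ a ⋆ c ⊕ b ⋆ c
⋆-distribʳ c a b zero    = *-distribʳ-+ (c 0) (a 0) (b 0)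
⋆-distribʳ c a b (suc n) = begin
  (a 0 + b 0) * c (suc n) + ((drop 1 a ⊕ drop 1 b) ⋆ c) n
    ≡⟨ cong₂ _+_ (*-distribʳ-+ (c (suc n)) (a 0) (b 0)) (⋆-distribʳ c (drop 1 a) (drop 1 b) n) ⟩
  (a 0 * c (suc n) + b 0 * c (suc n)) + ((drop 1 a ⋆ c) n + (drop 1 b ⋆ c) n)
    ≡⟨ interchange (a 0 * c (suc n)) (b 0 * c (suc n)) ((drop 1 a ⋆ c) n) ((drop 1 b ⋆ c) n) ⟩
  (a ⋆ c ⊕ b ⋆ c) (suc n) ∎
  where open ≡-Reasoning

⋆-scaleˡ : ∀ c a b → scale c a ⋆ b ≈ scale c (a ⋆ b)
⋆-scaleˡ c a b zero    = *-assoc c (a 0) (b 0)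
⋆-scaleˡ c a b (suc n) = begin
  c * a 0 * b (suc n) + (scale c (drop 1 a) ⋆ b) n
    ≡⟨ cong₂ _+_ (*-assoc c (a 0) (b (suc n))) (⋆-scaleˡ c (drop 1 a) b n) ⟩
  c * (a 0 * b (suc n)) + c * (drop 1 a ⋆ b) n
    ≡⟨ *-distribˡ-+ c (a 0 * b (suc n)) ((drop 1 a ⋆ b) n) ⟨
  c * (a ⋆ b) (suc n) ∎
  where open ≡-Reasoning

⋆-unfoldʳ : ∀ a b n → (a ⋆ b) (suc n) ≡ (a ⋆ drop 1 b) n + a (suc n) * b 0
⋆-unfoldʳ a b zero    = refl
⋆-unfoldʳ a b (suc n) = begin
  a 0 * b (2 + n) + (drop 1 a ⋆ b) (suc n)
    ≡⟨ cong (a 0 * b (2 + n) +_) (⋆-unfoldʳ (drop 1 a) b n) ⟩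
  a 0 * b (2 + n) + ((drop 1 a ⋆ drop 1 b) n + a (2 + n) * b 0)
    ≡⟨ +-assoc (a 0 * b (2 + n)) _ _ ⟨
  (a ⋆ drop 1 b) (suc n) + a (2 + n) * b 0 ∎
  where open ≡-Reasoning

⋆-comm : ∀ a b → a ⋆ b ≈ b ⋆ a
⋆-comm a b zero    = *-comm (a 0) (b 0)
⋆-comm a b (suc n) = begin
  a 0 * b (suc n) + (drop 1 a ⋆ b) n   ≡⟨ cong₂ _+_ (*-comm (a 0) (b (suc n))) (⋆-comm (drop 1 a) b n) ⟩
  b (suc n) * a 0 + (b ⋆ drop 1 a) n   ≡⟨ +-comm (b (suc n) * a 0) _ ⟩
  (b ⋆ drop 1 a) n + b (suc n) * a 0   ≡⟨ ⋆-unfoldʳ b a n ⟨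
  (b ⋆ a) (suc n)                      ∎
  where open ≡-Reasoning

⋆-assoc : ∀ a b c → (a ⋆ b) ⋆ c ≈ a ⋆ (b ⋆ c)
⋆-assoc a b c zero    = *-assoc (a 0) (b 0) (c 0)
⋆-assoc a b c (suc n) = begin
  a 0 * b 0 * c (suc n) + ((scale (a 0) (drop 1 b) ⊕ drop 1 a ⋆ b) ⋆ c) n
    ≡⟨ cong (a 0 * b 0 * c (suc n) +_) (⋆-distribʳ c (scale (a 0) (drop 1 b)) (drop 1 a ⋆ b) n) ⟩
  a 0 * b 0 * c (suc n) + ((scale (a 0) (drop 1 b) ⋆ c) n + ((drop 1 a ⋆ b) ⋆ c) n)
    ≡⟨ cong₂ (λ s t → a 0 * b 0 * c (suc n) + (s + t))
             (⋆-scaleˡ (a 0) (drop 1 b) c n) (⋆-assoc (drop 1 a) b c n) ⟩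
  a 0 * b 0 * c (suc n) + (a 0 * (drop 1 b ⋆ c) n + (drop 1 a ⋆ (b ⋆ c)) n)
    ≡⟨ solve 5 (λ x y z u v → x :* y :* z :+ (x :* u :+ v) := x :* (y :* z :+ u) :+ v) refl
             (a 0) (b 0) (c (suc n)) _ _ ⟩
  (a ⋆ (b ⋆ c)) (suc n) ∎
  where open ≡-Reasoning
        open Data.Nat.Solver.+-*-Solver

⊗≈⋆ : ∀ a b → a ⊗ b ≈ a ⋆ b
⊗≈⋆ a b n = trans (cong sum (map-applyUpTo id _ (suc n))) (sum≡⋆ n a)
  where
  sum≡⋆ : ∀ n a → sum (applyUpTo (λ k → a k * b (n ∸ k)) (suc n)) ≡ (a ⋆ b) n
  sum≡⋆ zero    a = +-identityʳ _
  sum≡⋆ (suc n) a = cong (a 0 * b (suc n) +_) (sum≡⋆ n (drop 1 a))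

⊗-via-⋆ : ∀ {a b c d} → a ⋆ b ≈ c ⋆ d → a ⊗ b ≈ c ⊗ d
⊗-via-⋆ {a} {b} {c} {d} p n = trans (⊗≈⋆ a b n) (trans (p n) (sym (⊗≈⋆ c d n)))

series-commutativeSemiring : CommutativeSemiring 0ℓ 0ℓ
series-commutativeSemiring = record
  { Carrier = Series ; _≈_ = _≈_ ; _+_ = _⊕_ ; _*_ = _⊗_ ; 0# = 𝟘 ; 1# = one
  ; isCommutativeSemiring = isCommutativeSemiringˡ record
    { +-isCommutativeMonoid = isCommutativeMonoidˡ record
      { isSemigroup = record
        { isMagma = record { isEquivalence = ≈-isEquivalence ; ∙-cong = λ p q n → cong₂ _+_ (p n) (q n) }
        ; assoc   = λ a b c n → +-assoc (a n) (b n) (c n) }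
      ; identityˡ = λ a n → refl
      ; comm      = λ a b n → +-comm (a n) (b n) }
    ; *-isCommutativeMonoid = isCommutativeMonoidˡ record
      { isSemigroup = record
        { isMagma = record { isEquivalence = ≈-isEquivalence ; ∙-cong = λ p q → ⊗-via-⋆ (⋆-cong p q) }
        ; assoc   = ⊗-assoc }
      ; identityˡ = λ b n → trans (⊗≈⋆ one b n) (⋆-identityˡ b n)
      ; comm      = λ a b → ⊗-via-⋆ (⋆-comm a b) }
    ; distribʳ = λ c a b n →
        trans (⊗≈⋆ (a ⊕ b) c n)
              (trans (⋆-distribʳ c a b n) (sym (cong₂ _+_ (⊗≈⋆ a c n) (⊗≈⋆ b c n))))
    ; zeroˡ = λ b n → trans (⊗≈⋆ 𝟘 b n) (⋆-zeroˡ b n) }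
  }
  where
  open import Algebra.Structures.Biased {A = Series} _≈_ using (isCommutativeSemiringˡ; isCommutativeMonoidˡ)

  ≈-isEquivalence : IsEquivalence _≈_
  ≈-isEquivalence = record
    { refl = λ n → refl ; sym = λ p n → sym (p n) ; trans = λ p q n → trans (p n) (q n) }

  ⊗-assoc : ∀ a b c → (a ⊗ b) ⊗ c ≈ a ⊗ (b ⊗ c)
  ⊗-assoc a b c = ⊗-via-⋆ λ n → begin
    ((a ⊗ b) ⋆ c) n  ≡⟨ ⋆-cong (⊗≈⋆ a b) (λ _ → refl) n ⟩
    ((a ⋆ b) ⋆ c) n  ≡⟨ ⋆-assoc a b c n ⟩
    (a ⋆ (b ⋆ c)) n  ≡⟨ ⋆-cong (λ _ → refl) (⊗≈⋆ b c) n ⟨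
    (a ⋆ (b ⊗ c)) n  ∎
    where open ≡-Reasoning

open CommutativeSemiring series-commutativeSemiring
  using (+-cong; *-cong)
  renaming (*-comm to ⊗-comm; setoid to ≈-setoid; refl to ≈-refl; sym to ≈-sym)

Agree : ℕ → Series → Series → Set
Agree k a b = ∀ m → m < k → a m ≡ b m

⋆-agree : ∀ {k a a' b b'} → Agree k a a' → Agree k b b' → Agree k (a ⋆ b) (a' ⋆ b')
⋆-agree p q zero    lt = cong₂ _*_ (p 0 lt) (q 0 lt)
⋆-agree {suc k} p q (suc m) (s≤s lt) =
  cong₂ _+_ (cong₂ _*_ (p 0 (s≤s z≤n)) (q (suc m) (s≤s lt)))
            (⋆-agree (λ i i<k → p (suc i) (s≤s i<k)) (λ i i<k → q i (m<n⇒m<1+n i<k)) m lt)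

⊗-constantTerm : ∀ a b → a 0 ≡ 0 → (a ⊗ b) 0 ≡ 0
⊗-constantTerm a b a₀ = trans (⊗≈⋆ a b 0) (cong (_* b 0) a₀)

⋆-unfold-constantFree : ∀ a b n → a 0 ≡ 0 → (a ⋆ b) (suc n) ≡ (drop 1 a ⋆ b) n
⋆-unfold-constantFree a b n a₀ = cong (λ c → c * b (suc n) + (drop 1 a ⋆ b) n) a₀

⊗-agree-constantFree : ∀ {k} a {b b'} → a 0 ≡ 0 → Agree k b b' → Agree (suc k) (a ⊗ b) (a ⊗ b')
⊗-agree-constantFree a {b} {b'} a₀ q zero _ =
  trans (⊗-constantTerm a b a₀) (sym (⊗-constantTerm a b' a₀))
⊗-agree-constantFree a {b} {b'} a₀ q (suc m) (s≤s lt) = begin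
  (a ⊗ b) (suc m)       ≡⟨ ⊗≈⋆ a b (suc m) ⟩
  (a ⋆ b) (suc m)       ≡⟨ ⋆-unfold-constantFree a b m a₀ ⟩
  (drop 1 a ⋆ b) m      ≡⟨ ⋆-agree {suc m} (λ _ _ → refl) (λ i i<1+m → q i (≤-trans i<1+m lt))
                                   m ≤-refl ⟩
  (drop 1 a ⋆ b') m     ≡⟨ ⋆-unfold-constantFree a b' m a₀ ⟨
  (a ⋆ b') (suc m)      ≡⟨ ⊗≈⋆ a b' (suc m) ⟨
  (a ⊗ b') (suc m)      ∎
  where open ≡-Reasoning

-- The accumulators invAux and chains of Defs both satisfy this recurrence.
drop-⋆-unique : ∀ φ c (acc : ℕ → ℕ → ℕ)
  → (∀ d → acc d 0 ≡ φ (suc d) * c 0)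
  → (∀ d n → acc d (suc n) ≡ φ (suc d) * c (suc n) + acc (suc d) n)
  → ∀ d n → acc d n ≡ (drop (suc d) φ ⋆ c) n
drop-⋆-unique φ c acc acc-zero acc-suc d zero =
  trans (acc-zero d) (cong (λ i → φ (suc i) * c 0) (sym (+-identityʳ d)))
drop-⋆-unique φ c acc acc-zero acc-suc d (suc n) = begin
  acc d (suc n)
    ≡⟨ acc-suc d n ⟩
  φ (suc d) * c (suc n) + acc (suc d) n
    ≡⟨ cong₂ _+_ (cong (λ i → φ (suc i) * c (suc n)) (sym (+-identityʳ d)))
                 (drop-⋆-unique φ c acc acc-zero acc-suc (suc d) n) ⟩
  φ (suc (d + 0)) * c (suc n) + (drop (2 + d) φ ⋆ c) n
    ≡⟨ cong (φ (suc (d + 0)) * c (suc n) +_)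
            (⋆-cong (λ k → cong (λ i → φ (suc i)) (sym (+-suc d k))) (λ _ → refl) n) ⟩
  (drop (suc d) φ ⋆ c) (suc n) ∎
  where open ≡-Reasoning

inv-unfold : ∀ X n → inv X (suc n) ≡ (drop 1 X ⋆ inv X) n
inv-unfold X = drop-⋆-unique X (inv X) (invAux X) (λ _ → refl) (λ _ _ → refl) 0

inv-fixedPoint : ∀ X → X 0 ≡ 0 → inv X ≈ one ⊕ X ⊗ inv X
inv-fixedPoint X X₀ zero    = cong suc (sym (⊗-constantTerm X (inv X) X₀))
inv-fixedPoint X X₀ (suc n) = begin
  inv X (suc n)             ≡⟨ inv-unfold X n ⟩
  (drop 1 X ⋆ inv X) n      ≡⟨ ⋆-unfold-constantFree X (inv X) n X₀ ⟨
  (X ⋆ inv X) (suc n)       ≡⟨ ⊗≈⋆ X (inv X) (suc n) ⟨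
  (X ⊗ inv X) (suc n)       ∎
  where open ≡-Reasoning

inv-agree : ∀ {k X Y} → Agree k X Y → Agree k (inv X) (inv Y)
inv-agree p zero lt = refl
inv-agree {suc k} {X} {Y} p (suc m) (s≤s lt) = begin
  inv X (suc m)          ≡⟨ inv-unfold X m ⟩
  (drop 1 X ⋆ inv X) m   ≡⟨ ⋆-agree (λ i i<k → p (suc i) (s≤s i<k))
                                    (inv-agree (λ i i<k → p i (m<n⇒m<1+n i<k))) m lt ⟩
  (drop 1 Y ⋆ inv Y) m   ≡⟨ inv-unfold Y m ⟨
  inv Y (suc m)          ∎
  where open ≡-Reasoning

Contractive : {S : Set} → ((S → Series) → S → Series) → Set
Contractive F = ∀ {k Q Q'} → (∀ s → Agree k (Q s) (Q' s)) → ∀ s → F Q s k ≡ F Q' s k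

contractive-fixedPoints-equal : ∀ {S : Set} {F : (S → Series) → S → Series} {Q Q' : S → Series}
  → Contractive F → (∀ s → Q s ≈ F Q s) → (∀ s → Q' s ≈ F Q' s) → ∀ s → Q s ≈ Q' s
contractive-fixedPoints-equal {S} {F} {Q} {Q'} contractive Q-fixed Q'-fixed s n =
  agree (suc n) s n ≤-refl
  where
  agree : ∀ k s → Agree k (Q s) (Q' s)
  agree zero    s m ()
  agree (suc k) s m m<1+k with m<1+n⇒m<n∨m≡n m<1+k
  ... | inj₁ m<k  = agree k s m m<k
  ... | inj₂ refl = trans (Q-fixed s m) (trans (contractive (agree m) s) (sym (Q'-fixed s m)))

module ContinuedFraction (h f g : ℕ → Series) (h₀ : ∀ i → h i 0 ≡ 0) (f₀ : ∀ i → f i 0 ≡ 0) where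

  level : ℕ → Series → Series
  level j T = h j ⊕ f j ⊗ g j ⊗ T

  level-agree : ∀ {k T T'} j → Agree k T T' → Agree (suc k) (level j T) (level j T')
  level-agree j p m lt =
    cong (h j m +_) (⊗-agree-constantFree (f j ⊗ g j) (⊗-constantTerm (f j) (g j) (f₀ j)) p m lt)

  trunc-constantTerm : ∀ m j → trunc h f g m j 0 ≡ 1
  trunc-constantTerm zero    j = refl
  trunc-constantTerm (suc m) j = refl

  trunc-stable : ∀ {k m} j → k ≤ m → Agree (suc k) (trunc h f g m j) (trunc h f g k j)
  trunc-stable {zero}  {m}     j _ zero    _        = trunc-constantTerm m j
  trunc-stable {zero}  {m}     j _ (suc i) (s≤s ())
  trunc-stable {suc k} {suc m} j (s≤s k≤m) = inv-agree (level-agree j (trunc-stable (suc j) k≤m))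

  E : ℕ → Series
  E j n = trunc h f g n j n

  E-isLimit : ∀ j → IsLimit (λ m → trunc h f g m j) (E j)
  E-isLimit j n = n , λ m n≤m → trunc-stable j n≤m n ≤-refl

  trunc-agree-E : ∀ k j → Agree (suc k) (trunc h f g k j) (E j)
  trunc-agree-E k j m m<1+k = trunc-stable j (≤-pred m<1+k) m ≤-refl

  E-inv : ∀ j → E j ≈ inv (level j (E (suc j)))
  E-inv j zero    = refl
  E-inv j (suc n) = inv-agree (level-agree j (trunc-agree-E n (suc j))) (suc n) ≤-refl

  E-fixedPoint : ∀ j → E j ≈ one ⊕ level j (E (suc j)) ⊗ E j
  E-fixedPoint j = begin
    E j                         ≈⟨ E-inv j ⟩
    inv L                       ≈⟨ inv-fixedPoint L L₀ ⟩
    one ⊕ L ⊗ inv L             ≈⟨ +-cong (≈-refl {one}) (*-cong (≈-refl {L}) (≈-sym (E-inv j))) ⟩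
    one ⊕ L ⊗ E j               ∎
    where
    open SetoidReasoning ≈-setoid
    L : Series
    L = level j (E (suc j))
    L₀ : L 0 ≡ 0
    L₀ = cong₂ _+_ (h₀ j) (⊗-constantTerm (f j ⊗ g j) (E (suc j)) (⊗-constantTerm (f j) (g j) (f₀ j)))

Arrow : Set
Arrow = Series × ℤ

Arrows : Set
Arrows = Arrow × Arrow × Arrow

total : (Arrow → ℕ) → Arrows → ℕ
total F (a , b , c) = F a + F b + F c

ConstantFree : Arrow → Set
ConstantFree (φ , _) = φ 0 ≡ 0

AllConstantFree : Arrows → Set
AllConstantFree (a , b , c) = ConstantFree a × ConstantFree b × ConstantFree c

total-cong : ∀ {F G : Arrow → ℕ} → (∀ a → ConstantFree a → F a ≡ G a)
  → ∀ as → AllConstantFree as → total F as ≡ total G as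
total-cong F≡G (a , b , c) (a₀ , b₀ , c₀) = cong₂ _+_ (cong₂ _+_ (F≡G a a₀) (F≡G b b₀)) (F≡G c c₀)

module Automaton (h f g h' f' g' : ℕ → Series)
  (h₀ : ∀ i → h i 0 ≡ 0) (f₀ : ∀ i → f i 0 ≡ 0) (g₀ : ∀ i → g i 0 ≡ 0)
  (h'₀ : ∀ i → h' i 0 ≡ 0) (f'₀ : ∀ i → f' i 0 ≡ 0) (g'₀ : ∀ i → g' i 0 ≡ 0) where
  open BLin h f g h' f' g'
  open Balance series-commutativeSemiring

  -- In the order of the summands of paths, so that paths-unfold holds by refl.
  arrows : ℤ → Arrows
  arrows +0       = (h 0 , +0) , (f 0 , +[1+ 0 ]) , (g' 0 , -[1+ 0 ])
  arrows +[1+ i ] = (h (suc i) , +[1+ i ]) , (f (suc i) , +[1+ suc i ]) , (g i , ℤ.+ i)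
  arrows -[1+ i ] = (h' (suc i) , -[1+ i ]) , (g' (suc i) , -[1+ suc i ]) , (f' i , neg i)

  arrows-constantFree : ∀ s → AllConstantFree (arrows s)
  arrows-constantFree +0       = h₀ 0 , f₀ 0 , g'₀ 0
  arrows-constantFree +[1+ i ] = h₀ (suc i) , f₀ (suc i) , g₀ i
  arrows-constantFree -[1+ i ] = h'₀ (suc i) , g'₀ (suc i) , f'₀ i

  start : ℤ → Series
  start +0       = one
  start +[1+ _ ] = 𝟘
  start -[1+ _ ] = 𝟘

  follow : (ℤ → Series) → Arrow → Series
  follow Q (φ , q) = φ ⊗ Q q

  step : (ℤ → Series) → ℤ → Series
  step Q s n = start s n + total (λ a → follow Q a n) (arrows s)

  step-contractive : Contractive step
  step-contractive {k} agree s =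
    cong (start s k +_) (total-cong (λ { (φ , q) φ₀ → ⊗-agree-constantFree φ φ₀ (agree q) k ≤-refl })
                                    (arrows s) (arrows-constantFree s))

  pathsFrom : ℤ → Series
  pathsFrom s n = paths n s

  pathsVia : ℕ → Arrow → ℕ
  pathsVia zero    _       = 0
  pathsVia (suc n) (φ , q) = chains φ q 0 n

  paths-unfold : ∀ n s → paths n s ≡ start s n + total (pathsVia n) (arrows s)
  paths-unfold zero    +0       = refl
  paths-unfold zero    +[1+ _ ] = refl
  paths-unfold zero    -[1+ _ ] = refl
  paths-unfold (suc n) +0       = refl
  paths-unfold (suc n) +[1+ _ ] = refl
  paths-unfold (suc n) -[1+ _ ] = refl

  pathsVia-follow : ∀ n a → ConstantFree a → pathsVia n a ≡ follow pathsFrom a n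
  pathsVia-follow zero    (φ , q) φ₀ = sym (⊗-constantTerm φ (pathsFrom q) φ₀)
  pathsVia-follow (suc n) (φ , q) φ₀ = begin
    chains φ q 0 n
      ≡⟨ drop-⋆-unique φ (pathsFrom q) (chains φ q) (λ _ → refl) (λ _ _ → refl) 0 n ⟩
    (drop 1 φ ⋆ pathsFrom q) n
      ≡⟨ ⋆-unfold-constantFree φ (pathsFrom q) n φ₀ ⟨
    (φ ⋆ pathsFrom q) (suc n)
      ≡⟨ ⊗≈⋆ φ (pathsFrom q) (suc n) ⟨
    (φ ⊗ pathsFrom q) (suc n) ∎
    where open ≡-Reasoning

  paths-fixedPoint : ∀ s → pathsFrom s ≈ step pathsFrom s
  paths-fixedPoint s n =
    trans (paths-unfold n s)
          (cong (start s n +_) (total-cong (pathsVia-follow n) (arrows s) (arrows-constantFree s)))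

  open ContinuedFraction h f g h₀ f₀ public using (E; E-isLimit; E-fixedPoint)
  open ContinuedFraction h' f' g' h'₀ f'₀ public using ()
    renaming (E to E'; E-isLimit to E'-isLimit; E-fixedPoint to E'-fixedPoint)

  ladder : Series → (ℕ → Series) → ℕ → Series
  ladder b r zero    = b
  ladder b r (suc i) = ladder b r i ⊗ r i

  closedForm : ℤ → Series
  closedForm (ℤ.+ i)  = ladder (Eb (E 1) (E' 1)) (λ k → g k ⊗ E (suc k)) i
  closedForm -[1+ i ] = ladder (Eb (E 1) (E' 1)) (λ k → f' k ⊗ E' (suc k)) (suc i)

  closedForm-fixedPoint : ∀ s → closedForm s ≈ step closedForm s
  closedForm-fixedPoint +0 =
    root-balance (Eb (E 1) (E' 1)) (h 0) (f 0) (g 0) (E 1) (f' 0) (g' 0) (E' 1) (inv-fixedPoint Y Y₀)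
    where
    Y : Series
    Y = h 0 ⊕ f 0 ⊗ g 0 ⊗ E 1 ⊕ f' 0 ⊗ g' 0 ⊗ E' 1
    Y₀ : Y 0 ≡ 0
    Y₀ = cong₂ _+_
      (cong₂ _+_ (h₀ 0) (⊗-constantTerm (f 0 ⊗ g 0) (E 1) (⊗-constantTerm (f 0) (g 0) (f₀ 0))))
      (⊗-constantTerm (f' 0 ⊗ g' 0) (E' 1) (⊗-constantTerm (f' 0) (g' 0) (f'₀ 0)))
  closedForm-fixedPoint +[1+ i ] =
    rung-balance (closedForm (ℤ.+ i)) (g i) (E (suc i)) (h (suc i)) (f (suc i)) (g (suc i)) (E (2 + i))
      ≈-refl (E-fixedPoint (suc i))
  closedForm-fixedPoint -[1+ zero ] =
    rung-balance (closedForm +0) (f' 0) (E' 1) (h' 1) (g' 1) (f' 1) (E' 2)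
      (⊗-comm (f' 1) (g' 1)) (E'-fixedPoint 1)
  closedForm-fixedPoint -[1+ suc i ] =
    rung-balance (closedForm -[1+ i ]) (f' (suc i)) (E' (2 + i)) (h' (2 + i)) (g' (2 + i)) (f' (2 + i)) (E' (3 + i))
      (⊗-comm (f' (2 + i)) (g' (2 + i))) (E'-fixedPoint (2 + i))

  genFun≈Eb : genFun ≈ Eb (E 1) (E' 1)
  genFun≈Eb = contractive-fixedPoints-equal step-contractive paths-fixedPoint closedForm-fixedPoint +0

mainTheorem7 : (h f g h' f' g' : ℕ → Series)
    → (∀ i → h i 0 ≡ 0) → (∀ i → f i 0 ≡ 0) → (∀ i → g i 0 ≡ 0)
    → (∀ i → h' i 0 ≡ 0) → (∀ i → f' i 0 ≡ 0) → (∀ i → g' i 0 ≡ 0)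
    → Σ Series (λ E1 → Σ Series (λ E1' →
        IsLimit (λ m → trunc h f g m 1) E1
        × IsLimit (λ m → trunc h' f' g' m 1) E1'
        × (∀ n → BLin.genFun h f g h' f' g' n ≡ BLin.Eb h f g h' f' g' E1 E1' n)))
mainTheorem7 h f g h' f' g' h₀ f₀ g₀ h'₀ f'₀ g'₀ = E 1 , E' 1 , E-isLimit 1 , E'-isLimit 1 , genFun≈Eb
  where open Automaton h f g h' f' g' h₀ f₀ g₀ h'₀ f'₀ g'₀
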